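{- Let $He_-^\bullet(X)$ be the mould on $\mathrm{seq}(\mathbb{N}^*)$ with values in $\mathbb{C}[[X]]$ defined by $He_-^{\underline s}(X)=(-1)^{\|\underline s\|}He_+^{\overleftarrow{\underline s}}(-X)$, and let $Hig_-^\bullet(X)$ be its generating function. Define $\mathcal{Z}ig_-^{Y_1,\dots,Y_r}=(-1)^r\mathcal{Z}ig^{ -Y_r,\dots,-Y_1}$. Then for every $r\ge1$, $$Hig_-^{Y_1,\dots,Y_r}(X)=\mathcal{Z}ig_-^{Y_1-X,\dots,Y_r-X}\quad\text{in }\mathbb{C}[[X,Y_1,\dots,Y_r]].$$
   Context: $\mathrm{seq}(\mathbb{N}^*)$: finite sequences of positive integers including $\emptyset$; $\|\underline s\|=\sum s_i$; $\overleftarrow{\underline s}=(s_r,\dots,s_1)$. $\mathcal{Z}e^\bullet$ is the extended multizeta mould: $\mathcal{Z}e^{\underline s}=\sum_{n_1>\dots>n_r>0}\prod n_i^{ -s_i}$ for $s_1\ge2$, $\mathcal Ze^\emptyset=1$, extended as the unique symmetrel mould on $\mathrm{seq}(\mathbb N^*)$ with $\mathcal Ze^{(1)}=0$ (symmetrel: $M^\emptyset=1$, $M^{\underline a}M^{\underline b}=\sum_{\underline\gamma\in\mathrm{she}(\underline a;\underline b)}M^{\underline\gamma}$, stuffle $\mathrm{she}$ defined by $\mathrm{she}(\underline a;\emptyset)=\mathrm{she}(\emptyset;\underline a)=\{\underline a\}$, $\mathrm{she}(a_1\cdot\underline a';b_1\cdot\underline b')=a_1\cdot\mathrm{she}(\underline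 a';b_1\cdot\underline b')\cup b_1\cdot\mathrm{she}(a_1\cdot\underline a';\underline b')\cup(a_1+b_1)\cdot\mathrm{she}(\underline a';\underline b')$). $He_+^{\underline s}(X)=\sum_{k_1,\dots,k_r\ge0}\prod_i\binom{s_i+k_i-1}{k_i}\mathcal{Z}e^{s_1+k_1,\dots,s_r+k_r}(-X)^{k_1+\dots+k_r}$, $He_+^\emptyset=1$. Generating function of a mould $M^\bullet$: $Mig^\emptyset=1$, $Mig^{v_1,\dots,v_r}=\sum_{s_i\ge1}M^{s_1,\dots,s_r}v_1^{s_1-1}\cdots v_r^{s_r-1}$; $\mathcal Zig^\bullet$ is that of $\mathcal Ze^\bullet$. -}

module Defs where

open import Level using (Level)
open import Data.Nat as ℕ using (ℕ; zero; suc; _∸_; NonZero)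
open import Data.Nat.Combinatorics using (_C_)
open import Data.Fin using (Fin; zero; suc; opposite)
open import Data.List as List using (List; []; _∷_; map; concatMap; upTo; foldr)
open import Data.List.Relation.Unary.All using (All)
open import Data.Vec as Vec using (Vec; []; _∷_; lookup; toList; zipWith)
open import Data.Product using (_×_; _,_)
open import Algebra.Bundles using (CommutativeRing)

comps : (m d : ℕ) → List (Vec ℕ m)
comps zero zero    = [] ∷ []
comps zero (suc d) = []
comps (suc m) d    = concatMap (λ k → map (k ∷_) (comps m (d ∸ k))) (upTo (suc d))

splits : ∀ {m} → Vec ℕ m → List (Vec ℕ m × Vec ℕ m)
splits []      = ([] , []) ∷ []
splits (x ∷ e) =
  concatMap (λ a → map (λ { (p , q) → (a ∷ p , (x ∸ a) ∷ q) }) (splits e)) (upTo (suc x))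

deg : ∀ {m} → Vec ℕ m → ℕ
deg = Vec.sum

-- stuffle (quasi-shuffle) 'she', as a list (= multiset) of sequences
she : List ℕ → List ℕ → List (List ℕ)
she []       b        = b ∷ []
she (a ∷ as) []       = (a ∷ as) ∷ []
she (a ∷ as) (b ∷ bs) =
  map (a ∷_) (she as (b ∷ bs))
  List.++ map (b ∷_) (she (a ∷ as) bs)
  List.++ map ((a ℕ.+ b) ∷_) (she as bs)

-- Everything over a commutative ring R (the coefficient ring, ℂ in the paper)

module _ {c ℓ : Level} (R : CommutativeRing c ℓ) where
  open CommutativeRing R using (Carrier; _≈_; _+_; _*_; -_; 0#; 1#)

  sumL : List Carrier → Carrier
  sumL = foldr _+_ 0#

  prodL : List Carrier → Carrier
  prodL = foldr _*_ 1#

  signPow : ℕ → Carrier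
  signPow zero    = 1#
  signPow (suc n) = - (signPow n)

  natCast : ℕ → Carrier
  natCast zero    = 0#
  natCast (suc n) = 1# + natCast n

  -- formal power series in m variables: coefficient of the monomial with exponent vector e
  Series : ℕ → Set c
  Series m = Vec ℕ m → Carrier

  oneS : ∀ {m} → Series m
  oneS []          = 1#
  oneS (zero ∷ e)  = oneS e
  oneS (suc _ ∷ e) = 0#

  var : ∀ {m} → Fin m → Series m
  var zero    (zero ∷ e)          = 0#
  var zero    (suc zero ∷ e)      = oneS e
  var zero    (suc (suc _) ∷ e)   = 0#
  var (suc i) (zero ∷ e)          = var i e
  var (suc i) (suc _ ∷ e)         = 0#

  addS : ∀ {m} → Series m → Series m → Series m
  addS f g e = f e + g e

  negS : ∀ {m} → Series m → Series m
  negS f e = - (f e)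

  mulS : ∀ {m} → Series m → Series m → Series m
  mulS f g e = sumL (map (λ { (a , b) → f a * g b }) (splits e))

  powS : ∀ {m} → Series m → ℕ → Series m
  powS f zero    = oneS
  powS f (suc k) = mulS f (powS f k)

  prodS : ∀ {r m} → (Fin r → Series m) → Series m
  prodS {zero}  L = oneS
  prodS {suc r} L = mulS (L zero) (prodS (λ i → L (suc i)))

  -- substitution F(L_1,…,L_r) of series L_i into F; this formula (summing only
  -- over t with |t| = deg e) is the substitution for L_i homogeneous linear forms,
  -- which is the only case used below.
  substS : ∀ {r m} → Series r → (Fin r → Series m) → Series m
  substS {r} F L e =
    sumL (map (λ t → F t * prodS (λ i → powS (L i) (lookup t i)) e) (comps r (deg e)))

  -- moulds on seq(ℕ*) are functions List ℕ → R (only lists of positive entries matter)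

  Mould : Set c
  Mould = List ℕ → Carrier

  IsSymmetrel : Mould → Set ℓ
  IsSymmetrel M =
    (M [] ≈ 1#) ×
    (∀ (a b : List ℕ) → All NonZero a → All NonZero b →
       (M a * M b) ≈ sumL (map M (she a b)))

  -- generating function  Mig^{v_1..v_r} = Σ_{s_i ≥ 1} M^{s} v_1^{s_1-1} ⋯ v_r^{s_r-1}
  Mig : Mould → (r : ℕ) → Series r
  Mig M r e = M (toList (Vec.map suc e))

  HePlus : Mould → ∀ {r} → Vec ℕ r → Series 1
  HePlus Ze {r} s (n ∷ []) =
    sumL (map (λ k →
      prodL (toList (zipWith (λ si ki → natCast ((si ℕ.+ ki ∸ 1) C ki)) s k))
        * Ze (toList (zipWith ℕ._+_ s k))
        * signPow n)                       -- (-X)^{k_1+…+k_r} with k_1+…+k_r = n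
      (comps r n))

  HeMinus : Mould → ∀ {r} → Vec ℕ r → Series 1
  HeMinus Ze s e =
    signPow (Vec.sum s) * substS (HePlus Ze (Vec.reverse s)) (λ _ → negS (var zero)) e

  -- Hig_-^{Y_1..Y_r}(X) as a series in (X, Y_1, …, Y_r); variable 0 is X
  HigMinus : Mould → (r : ℕ) → Series (suc r)
  HigMinus Ze r (n ∷ e) = HeMinus Ze (Vec.map suc e) (n ∷ [])

  ZigMinus : Mould → (r : ℕ) → Series r
  ZigMinus Ze r e =
    signPow r * substS (Mig Ze r) (λ i → negS (var (opposite i))) e

  ZigMinusShifted : Mould → (r : ℕ) → Series (suc r)
  ZigMinusShifted Ze r =
    substS (ZigMinus Ze r) (λ i → addS (var (suc i)) (negS (var zero)))

module Submission where

-- The identity is a formal consequence of the Taylor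
-- expansion: it holds for every mould Ze with values in any commutative ring.
--
-- All series are evaluated in the monomial basis: the coefficient of x^b in
-- x^a is the Kronecker delta δ a b.  Finally both
-- sides at X^n Y^e are shown to equal
--   ∑_{|k| = n} (−1)^r (−1)^{|e|+n} Ze^{rev(e+k+1)} ∏ᵢ C(eᵢ+kᵢ, kᵢ) (−1)^{kᵢ}:
-- the left side by substituting −X and reversing the summation index of He_+,
-- the right side by expanding each Yᵢ − X binomially and collapsing the double sum.

open import Defs
open import Level using (Level)
open import Data.Bool using (Bool; true; false; if_then_else_)
open import Data.Nat as ℕ using (ℕ; zero; suc; _≤_; _<_; z≤n; s≤s)
import Data.Nat.Properties as ℕₚ
open import Data.Nat.Combinatorics using (_C_; nCk+nC[k+1]≡[n+1]C[k+1]; k>n⇒nCk≡0)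
open import Data.Fin using (Fin; zero; suc; opposite; fromℕ; inject₁)
open import Data.List as List using (List; []; _∷_; map; concatMap; upTo; applyUpTo; _++_)
import Data.List.Properties as Listₚ
open import Data.Vec as Vec using (Vec; []; _∷_; lookup; reverse; _∷ʳ_; toList; zipWith)
import Data.Vec.Properties as Vecₚ
open import Data.Vec.Relation.Binary.Pointwise.Inductive as Pointwise using (Pointwise; []; _∷_)
open import Data.Product using (_×_; _,_; proj₁; proj₂)
open import Function using (_∘_)
open import Relation.Binary.PropositionalEquality as ≡ using (_≡_; _≢_; refl; cong; cong₂; subst)
open import Relation.Nullary using (yes; no; ¬_; does)
open import Relation.Nullary.Decidable using (dec-true; dec-false)
open import Data.Empty using (⊥-elim)
open import Algebra.Bundles using (CommutativeRing)
import Algebra.Properties.CommutativeSemigroup as CommSemigroupProperties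
import Algebra.Properties.Ring as RingProperties
import Algebra.Solver.CommutativeMonoid as CommMonoidSolver
import Data.List.Relation.Binary.Permutation.Setoid.Properties as PermutationProperties

open CommSemigroupProperties ℕₚ.+-commutativeSemigroup using () renaming (interchange to ℕ+-interchange)

infixl 6 _⊕_ _⊖_
infixr 7 _⊙_

_⊕_ : ∀ {m} → Vec ℕ m → Vec ℕ m → Vec ℕ m
[]      ⊕ []      = []
(x ∷ v) ⊕ (y ∷ w) = (x ℕ.+ y) ∷ (v ⊕ w)

_⊙_ : ∀ {m} → ℕ → Vec ℕ m → Vec ℕ m
k ⊙ []      = []
k ⊙ (x ∷ v) = (k ℕ.* x) ∷ (k ⊙ v)

_⊖_ : ∀ {m} → Vec ℕ m → Vec ℕ m → Vec ℕ m
[]      ⊖ []      = []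
(x ∷ v) ⊖ (y ∷ w) = (x ℕ.∸ y) ∷ (v ⊖ w)

0ᵥ : ∀ {m} → Vec ℕ m
0ᵥ {zero}  = []
0ᵥ {suc m} = 0 ∷ 0ᵥ

𝐞 : ∀ {m} → Fin m → Vec ℕ m
𝐞 zero    = 1 ∷ 0ᵥ
𝐞 (suc i) = 0 ∷ 𝐞 i

lincomb : ∀ {r m} → (Fin r → Vec ℕ m) → Vec ℕ r → Vec ℕ m
lincomb α []       = 0ᵥ
lincomb α (u₀ ∷ u) = u₀ ⊙ α zero ⊕ lincomb (α ∘ suc) u

infix 4 _≤ᵥ_
_≤ᵥ_ : ∀ {m} → Vec ℕ m → Vec ℕ m → Set
e ≤ᵥ t = Pointwise _≤_ e t

⊕-assoc : ∀ {m} (a b d : Vec ℕ m) → (a ⊕ b) ⊕ d ≡ a ⊕ (b ⊕ d)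
⊕-assoc []      []      []      = refl
⊕-assoc (x ∷ a) (y ∷ b) (z ∷ d) = cong₂ _∷_ (ℕₚ.+-assoc x y z) (⊕-assoc a b d)

⊕-comm : ∀ {m} (a b : Vec ℕ m) → a ⊕ b ≡ b ⊕ a
⊕-comm []      []      = refl
⊕-comm (x ∷ a) (y ∷ b) = cong₂ _∷_ (ℕₚ.+-comm x y) (⊕-comm a b)

0ᵥ⊕ : ∀ {m} (a : Vec ℕ m) → 0ᵥ ⊕ a ≡ a
0ᵥ⊕ []      = refl
0ᵥ⊕ (x ∷ a) = cong (x ∷_) (0ᵥ⊕ a)

0⊙ : ∀ {m} (a : Vec ℕ m) → 0 ⊙ a ≡ 0ᵥ
0⊙ []      = refl
0⊙ (x ∷ a) = cong (0 ∷_) (0⊙ a)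

⊙0ᵥ : ∀ {m} k → k ⊙ 0ᵥ {m} ≡ 0ᵥ
⊙0ᵥ {zero}  k = refl
⊙0ᵥ {suc m} k = cong₂ _∷_ (ℕₚ.*-zeroʳ k) (⊙0ᵥ k)

suc⊙ : ∀ {m} k (a : Vec ℕ m) → suc k ⊙ a ≡ a ⊕ k ⊙ a
suc⊙ k []      = refl
suc⊙ k (x ∷ a) = cong (x ℕ.+ k ℕ.* x ∷_) (suc⊙ k a)

⊕⊖ : ∀ {m} (e k : Vec ℕ m) → (e ⊕ k) ⊖ e ≡ k
⊕⊖ []      []      = refl
⊕⊖ (x ∷ e) (y ∷ k) = cong₂ _∷_ (ℕₚ.m+n∸m≡n x y) (⊕⊖ e k)

⊕⊖-≤ : ∀ {m} {e t : Vec ℕ m} → e ≤ᵥ t → e ⊕ (t ⊖ e) ≡ t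
⊕⊖-≤ []            = refl
⊕⊖-≤ (e₀≤t₀ ∷ e≤t) = cong₂ _∷_ (ℕₚ.m+[n∸m]≡n e₀≤t₀) (⊕⊖-≤ e≤t)

≤ᵥ-⊕ : ∀ {m} (e k : Vec ℕ m) → e ≤ᵥ e ⊕ k
≤ᵥ-⊕ []      []      = []
≤ᵥ-⊕ (x ∷ e) (y ∷ k) = ℕₚ.m≤m+n x y ∷ ≤ᵥ-⊕ e k

deg-⊕ : ∀ {m} (a b : Vec ℕ m) → deg (a ⊕ b) ≡ deg a ℕ.+ deg b
deg-⊕ []      []      = refl
deg-⊕ (x ∷ a) (y ∷ b) = ≡.trans (cong (x ℕ.+ y ℕ.+_) (deg-⊕ a b)) (ℕ+-interchange x y (deg a) (deg b))

lincomb-0∷ : ∀ {r m} (u : Fin r → Vec ℕ m) v → lincomb (λ i → 0 ∷ u i) v ≡ 0 ∷ lincomb u v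
lincomb-0∷ u []       = refl
lincomb-0∷ u (v₀ ∷ v) =
  ≡.trans (cong (v₀ ⊙ (0 ∷ u zero) ⊕_) (lincomb-0∷ (u ∘ suc) v))
          (cong (_∷ (v₀ ⊙ u zero ⊕ lincomb (u ∘ suc) v)) (≡.trans (ℕₚ.+-identityʳ _) (ℕₚ.*-zeroʳ v₀)))

lincomb-𝐞 : ∀ {r} (v : Vec ℕ r) → lincomb 𝐞 v ≡ v
lincomb-𝐞 []       = refl
lincomb-𝐞 (v₀ ∷ v) =
  ≡.trans (cong (v₀ ⊙ 𝐞 zero ⊕_) (≡.trans (lincomb-0∷ 𝐞 v) (cong (0 ∷_) (lincomb-𝐞 v))))
          (cong₂ _∷_ (≡.trans (ℕₚ.+-identityʳ _) (ℕₚ.*-identityʳ v₀)) (≡.trans (cong (_⊕ v) (⊙0ᵥ v₀)) (0ᵥ⊕ v)))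

0ᵥ-∷ʳ : ∀ {m} → 0ᵥ {suc m} ≡ 0ᵥ {m} ∷ʳ 0
0ᵥ-∷ʳ {zero}  = refl
0ᵥ-∷ʳ {suc m} = cong (0 ∷_) (0ᵥ-∷ʳ {m})

⊙-∷ʳ : ∀ {m} k (v : Vec ℕ m) x → k ⊙ (v ∷ʳ x) ≡ (k ⊙ v) ∷ʳ (k ℕ.* x)
⊙-∷ʳ k []      x = refl
⊙-∷ʳ k (y ∷ v) x = cong (k ℕ.* y ∷_) (⊙-∷ʳ k v x)

⊕-∷ʳ : ∀ {m} (v w : Vec ℕ m) x y → (v ∷ʳ x) ⊕ (w ∷ʳ y) ≡ (v ⊕ w) ∷ʳ (x ℕ.+ y)
⊕-∷ʳ []      []      x y = refl
⊕-∷ʳ (a ∷ v) (b ∷ w) x y = cong (a ℕ.+ b ∷_) (⊕-∷ʳ v w x y)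

𝐞-fromℕ : ∀ r → 𝐞 (fromℕ r) ≡ 0ᵥ ∷ʳ 1
𝐞-fromℕ zero    = refl
𝐞-fromℕ (suc r) = cong (0 ∷_) (𝐞-fromℕ r)

𝐞-inject₁ : ∀ {r} (j : Fin r) → 𝐞 (inject₁ j) ≡ 𝐞 j ∷ʳ 0
𝐞-inject₁ zero    = cong (1 ∷_) 0ᵥ-∷ʳ
𝐞-inject₁ (suc j) = cong (0 ∷_) (𝐞-inject₁ j)

lincomb-cong : ∀ {r m} {α α′ : Fin r → Vec ℕ m} → (∀ i → α i ≡ α′ i) → ∀ u → lincomb α u ≡ lincomb α′ u
lincomb-cong α≡α′ []       = refl
lincomb-cong α≡α′ (u₀ ∷ u) = cong₂ _⊕_ (cong (u₀ ⊙_) (α≡α′ zero)) (lincomb-cong (α≡α′ ∘ suc) u)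

lincomb-∷ʳ0 : ∀ {r m} (α : Fin r → Vec ℕ m) u → lincomb (λ i → α i ∷ʳ 0) u ≡ lincomb α u ∷ʳ 0
lincomb-∷ʳ0 α []       = 0ᵥ-∷ʳ
lincomb-∷ʳ0 α (u₀ ∷ u) = begin
  u₀ ⊙ (α zero ∷ʳ 0) ⊕ lincomb (λ i → α (suc i) ∷ʳ 0) u
    ≡⟨ cong₂ _⊕_ (⊙-∷ʳ u₀ (α zero) 0) (lincomb-∷ʳ0 (α ∘ suc) u) ⟩
  (u₀ ⊙ α zero ∷ʳ u₀ ℕ.* 0) ⊕ (lincomb (α ∘ suc) u ∷ʳ 0)
    ≡⟨ ⊕-∷ʳ _ _ _ _ ⟩
  lincomb α (u₀ ∷ u) ∷ʳ (u₀ ℕ.* 0 ℕ.+ 0)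
    ≡⟨ cong (lincomb α (u₀ ∷ u) ∷ʳ_) (≡.trans (ℕₚ.+-identityʳ _) (ℕₚ.*-zeroʳ u₀)) ⟩
  lincomb α (u₀ ∷ u) ∷ʳ 0 ∎
  where open ≡.≡-Reasoning

lincomb-reverse : ∀ {r} (u : Vec ℕ r) → lincomb (𝐞 ∘ opposite) u ≡ reverse u
lincomb-reverse []               = refl
lincomb-reverse {suc r} (u₀ ∷ u) = begin
  u₀ ⊙ 𝐞 (fromℕ r) ⊕ lincomb (λ i → 𝐞 (inject₁ (opposite i))) u
    ≡⟨ cong₂ _⊕_ (cong (u₀ ⊙_) (𝐞-fromℕ r))
                 (≡.trans (lincomb-cong (𝐞-inject₁ ∘ opposite) u) (lincomb-∷ʳ0 (𝐞 ∘ opposite) u)) ⟩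
  u₀ ⊙ (0ᵥ ∷ʳ 1) ⊕ (lincomb (𝐞 ∘ opposite) u ∷ʳ 0)
    ≡⟨ cong₂ _⊕_ (⊙-∷ʳ u₀ 0ᵥ 1) (cong (_∷ʳ 0) (lincomb-reverse u)) ⟩
  (u₀ ⊙ 0ᵥ ∷ʳ u₀ ℕ.* 1) ⊕ (reverse u ∷ʳ 0)
    ≡⟨ ⊕-∷ʳ _ _ _ _ ⟩
  (u₀ ⊙ 0ᵥ ⊕ reverse u) ∷ʳ (u₀ ℕ.* 1 ℕ.+ 0)
    ≡⟨ cong₂ _∷ʳ_ (≡.trans (cong (_⊕ reverse u) (⊙0ᵥ u₀)) (0ᵥ⊕ _)) (≡.trans (ℕₚ.+-identityʳ _) (ℕₚ.*-identityʳ u₀)) ⟩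
  reverse u ∷ʳ u₀
    ≡⟨ Vecₚ.reverse-∷ u₀ u ⟨
  reverse (u₀ ∷ u) ∎
  where open ≡.≡-Reasoning

deg-∷ʳ : ∀ {m} (v : Vec ℕ m) x → deg (v ∷ʳ x) ≡ deg v ℕ.+ x
deg-∷ʳ []      x = ℕₚ.+-identityʳ x
deg-∷ʳ (y ∷ v) x = ≡.trans (cong (y ℕ.+_) (deg-∷ʳ v x)) (≡.sym (ℕₚ.+-assoc y (deg v) x))

deg-reverse : ∀ {m} (v : Vec ℕ m) → deg (reverse v) ≡ deg v
deg-reverse []      = refl
deg-reverse (x ∷ v) = begin
  deg (reverse (x ∷ v))      ≡⟨ cong deg (Vecₚ.reverse-∷ x v) ⟩
  deg (reverse v ∷ʳ x)       ≡⟨ deg-∷ʳ (reverse v) x ⟩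
  deg (reverse v) ℕ.+ x      ≡⟨ cong (ℕ._+ x) (deg-reverse v) ⟩
  deg v ℕ.+ x                ≡⟨ ℕₚ.+-comm (deg v) x ⟩
  x ℕ.+ deg v                ∎
  where open ≡.≡-Reasoning

zipWith-∷ʳ : ∀ {c} {A B : Set} {C : Set c} (f : A → B → C) {m} (v : Vec A m) (w : Vec B m) x y →
  zipWith f (v ∷ʳ x) (w ∷ʳ y) ≡ zipWith f v w ∷ʳ f x y
zipWith-∷ʳ f []      []      x y = refl
zipWith-∷ʳ f (a ∷ v) (b ∷ w) x y = cong (f a b ∷_) (zipWith-∷ʳ f v w x y)

zipWith-reverse : ∀ {c} {A B : Set} {C : Set c} (f : A → B → C) {m} (v : Vec A m) (w : Vec B m) →
  zipWith f (reverse v) (reverse w) ≡ reverse (zipWith f v w)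
zipWith-reverse f []      []      = refl
zipWith-reverse f (x ∷ v) (y ∷ w) = begin
  zipWith f (reverse (x ∷ v)) (reverse (y ∷ w))  ≡⟨ cong₂ (zipWith f) (Vecₚ.reverse-∷ x v) (Vecₚ.reverse-∷ y w) ⟩
  zipWith f (reverse v ∷ʳ x) (reverse w ∷ʳ y)    ≡⟨ zipWith-∷ʳ f (reverse v) (reverse w) x y ⟩
  zipWith f (reverse v) (reverse w) ∷ʳ f x y     ≡⟨ cong (_∷ʳ f x y) (zipWith-reverse f v w) ⟩
  reverse (zipWith f v w) ∷ʳ f x y               ≡⟨ Vecₚ.reverse-∷ (f x y) (zipWith f v w) ⟨
  reverse (zipWith f (x ∷ v) (y ∷ w))            ∎
  where open ≡.≡-Reasoning

zipWith-+-suc : ∀ {m} (e k : Vec ℕ m) → zipWith ℕ._+_ (Vec.map suc e) k ≡ Vec.map suc (e ⊕ k)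
zipWith-+-suc []      []      = refl
zipWith-+-suc (x ∷ e) (y ∷ k) = cong (suc (x ℕ.+ y) ∷_) (zipWith-+-suc e k)

deg-map-suc : ∀ {m} (e : Vec ℕ m) → deg (Vec.map suc e) ≡ m ℕ.+ deg e
deg-map-suc []              = refl
deg-map-suc {suc m} (x ∷ e) = cong suc (begin
  x ℕ.+ deg (Vec.map suc e)  ≡⟨ cong (x ℕ.+_) (deg-map-suc e) ⟩
  x ℕ.+ (m ℕ.+ deg e)        ≡⟨ ℕₚ.+-comm x (m ℕ.+ deg e) ⟩
  (m ℕ.+ deg e) ℕ.+ x        ≡⟨ ℕₚ.+-assoc m (deg e) x ⟩
  m ℕ.+ (deg e ℕ.+ x)        ≡⟨ cong (m ℕ.+_) (ℕₚ.+-comm (deg e) x) ⟩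
  m ℕ.+ (x ℕ.+ deg e)        ∎)
  where open ≡.≡-Reasoning

-- binomExp v w k a is the exponent a·w + (k − a)·v of the a-th term of (x^v − x^w)^k.
binomExp : ∀ {m} → Vec ℕ m → Vec ℕ m → ℕ → ℕ → Vec ℕ m
binomExp v w k a = a ⊙ w ⊕ (k ℕ.∸ a) ⊙ v

⊕-binomExp-v : ∀ {m} (v w : Vec ℕ m) k a → a ≤ k → v ⊕ binomExp v w k a ≡ binomExp v w (suc k) a
⊕-binomExp-v v w k a a≤k = begin
  v ⊕ (a ⊙ w ⊕ (k ℕ.∸ a) ⊙ v)   ≡⟨ ≡.sym (⊕-assoc v _ _) ⟩
  (v ⊕ a ⊙ w) ⊕ (k ℕ.∸ a) ⊙ v   ≡⟨ cong (_⊕ (k ℕ.∸ a) ⊙ v) (⊕-comm v (a ⊙ w)) ⟩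
  (a ⊙ w ⊕ v) ⊕ (k ℕ.∸ a) ⊙ v   ≡⟨ ⊕-assoc (a ⊙ w) v _ ⟩
  a ⊙ w ⊕ (v ⊕ (k ℕ.∸ a) ⊙ v)   ≡⟨ cong (a ⊙ w ⊕_) (≡.sym (suc⊙ (k ℕ.∸ a) v)) ⟩
  a ⊙ w ⊕ suc (k ℕ.∸ a) ⊙ v     ≡⟨ cong (λ j → a ⊙ w ⊕ j ⊙ v) (≡.sym (ℕₚ.+-∸-assoc 1 a≤k)) ⟩
  a ⊙ w ⊕ (suc k ℕ.∸ a) ⊙ v     ∎
  where open ≡.≡-Reasoning

⊕-binomExp-w : ∀ {m} (v w : Vec ℕ m) k a → w ⊕ binomExp v w k a ≡ binomExp v w (suc k) (suc a)
⊕-binomExp-w v w k a =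
  ≡.trans (≡.sym (⊕-assoc w (a ⊙ w) _)) (cong (_⊕ (k ℕ.∸ a) ⊙ v) (≡.sym (suc⊙ a w)))

below : ∀ {r} → Vec ℕ r → List (Vec ℕ r)
below []       = [] ∷ []
below (t₀ ∷ t) = concatMap (λ a₀ → map (a₀ ∷_) (below t)) (upTo (suc t₀))

binomExps : ∀ {r m} → (Fin r → Vec ℕ m) → Vec ℕ m → Vec ℕ r → Vec ℕ r → Vec ℕ m
binomExps v w []       []       = 0ᵥ
binomExps v w (t₀ ∷ t) (a₀ ∷ a) = binomExp (v zero) w t₀ a₀ ⊕ binomExps (v ∘ suc) w t a

binomExps-XY : ∀ {r} (t a : Vec ℕ r) → binomExps (𝐞 ∘ suc) (𝐞 zero) t a ≡ deg a ∷ (t ⊖ a)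
binomExps-XY t a = ≡.trans (shifted 𝐞 t a) (cong (deg a ∷_) (lincomb-𝐞 (t ⊖ a)))
  where
    shifted : ∀ {r m} (u : Fin r → Vec ℕ m) t a →
      binomExps (λ i → 0 ∷ u i) (𝐞 zero) t a ≡ deg a ∷ lincomb u (t ⊖ a)
    shifted u []       []       = refl
    shifted u (t₀ ∷ t) (a₀ ∷ a) =
      ≡.trans (cong (binomExp (0 ∷ u zero) (𝐞 zero) t₀ a₀ ⊕_) (shifted (u ∘ suc) t a))
              (cong₂ _∷_ (cong (ℕ._+ deg a) X-exponent) (cong (_⊕ lincomb (u ∘ suc) (t ⊖ a)) Y-exponent))
      where
        X-exponent : a₀ ℕ.* 1 ℕ.+ (t₀ ℕ.∸ a₀) ℕ.* 0 ≡ a₀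
        X-exponent = ≡.trans (cong₂ ℕ._+_ (ℕₚ.*-identityʳ a₀) (ℕₚ.*-zeroʳ (t₀ ℕ.∸ a₀))) (ℕₚ.+-identityʳ a₀)
        Y-exponent : a₀ ⊙ 0ᵥ ⊕ (t₀ ℕ.∸ a₀) ⊙ u zero ≡ (t₀ ℕ.∸ a₀) ⊙ u zero
        Y-exponent = ≡.trans (cong (_⊕ (t₀ ℕ.∸ a₀) ⊙ u zero) (⊙0ᵥ a₀)) (0ᵥ⊕ _)

module Expansion {c ℓ : Level} (R : CommutativeRing c ℓ) where
  open CommutativeRing R
    renaming (zero to *-zero; refl to ≈-refl; sym to ≈-sym; trans to ≈-trans)
  open import Relation.Binary.Reasoning.Setoid setoid
  open CommSemigroupProperties +-commutativeSemigroup using () renaming (interchange to +-interchange)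
  open CommSemigroupProperties *-commutativeSemigroup using () renaming (interchange to *-interchange)
  open RingProperties ring using (-1*x≈-x; -‿distribˡ-*; -‿distribʳ-*)
  open PermutationProperties setoid using (↭-reverse; foldr-commMonoid)

  ∑ : {A : Set} → List A → (A → Carrier) → Carrier
  ∑ xs f = sumL R (map f xs)

  syntax ∑ xs (λ x → t) = ∑[ x ∈ xs ] t

  ∑-cong : ∀ {A : Set} {f g : A → Carrier} xs → (∀ x → f x ≈ g x) → ∑ xs f ≈ ∑ xs g
  ∑-cong []       f≈g = ≈-refl
  ∑-cong (x ∷ xs) f≈g = +-cong (f≈g x) (∑-cong xs f≈g)

  ∑-zero : ∀ {A : Set} {f : A → Carrier} xs → (∀ x → f x ≈ 0#) → ∑ xs f ≈ 0#
  ∑-zero []       f≈0 = ≈-refl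
  ∑-zero (x ∷ xs) f≈0 = ≈-trans (+-cong (f≈0 x) (∑-zero xs f≈0)) (+-identityˡ 0#)

  ∑-++ : ∀ {A : Set} (f : A → Carrier) xs ys → ∑ (xs ++ ys) f ≈ ∑ xs f + ∑ ys f
  ∑-++ f []       ys = ≈-sym (+-identityˡ _)
  ∑-++ f (x ∷ xs) ys = ≈-trans (+-congˡ (∑-++ f xs ys)) (≈-sym (+-assoc _ _ _))

  ∑-+ : ∀ {A : Set} (f g : A → Carrier) xs → ∑[ x ∈ xs ] (f x + g x) ≈ ∑ xs f + ∑ xs g
  ∑-+ f g []       = ≈-sym (+-identityˡ 0#)
  ∑-+ f g (x ∷ xs) = ≈-trans (+-congˡ (∑-+ f g xs)) (+-interchange _ _ _ _)

  ∑-*ˡ : ∀ {A : Set} a (f : A → Carrier) xs → a * ∑ xs f ≈ ∑[ x ∈ xs ] (a * f x)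
  ∑-*ˡ a f []       = zeroʳ a
  ∑-*ˡ a f (x ∷ xs) = ≈-trans (distribˡ a _ _) (+-congˡ (∑-*ˡ a f xs))

  ∑-*ʳ : ∀ {A : Set} a (f : A → Carrier) xs → ∑ xs f * a ≈ ∑[ x ∈ xs ] (f x * a)
  ∑-*ʳ a f xs = ≈-trans (*-comm _ a) (≈-trans (∑-*ˡ a f xs) (∑-cong xs (λ x → *-comm a (f x))))

  ∑-map : ∀ {A B : Set} (g : A → B) (f : B → Carrier) xs → ∑ (map g xs) f ≡ ∑ xs (f ∘ g)
  ∑-map g f xs = cong (sumL R) (≡.sym (Listₚ.map-∘ xs))

  ∑-concatMap : ∀ {A B : Set} (h : B → Carrier) (F : A → List B) xs →
    ∑ (concatMap F xs) h ≈ ∑[ x ∈ xs ] ∑ (F x) h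
  ∑-concatMap h F []       = ≈-refl
  ∑-concatMap h F (x ∷ xs) = ≈-trans (∑-++ h (F x) (concatMap F xs)) (+-congˡ (∑-concatMap h F xs))

  ∑-swap : ∀ {A B : Set} (F : A → B → Carrier) xs ys →
    (∑[ x ∈ xs ] ∑[ y ∈ ys ] F x y) ≈ (∑[ y ∈ ys ] ∑[ x ∈ xs ] F x y)
  ∑-swap F []       ys = ≈-sym (∑-zero ys (λ _ → ≈-refl))
  ∑-swap F (x ∷ xs) ys =
    ≈-trans (+-congˡ (∑-swap F xs ys)) (≈-sym (∑-+ (F x) (λ y → ∑[ x′ ∈ xs ] F x′ y) ys))

  ∑-product : ∀ {A B : Set} (f : A → Carrier) (g : B → Carrier) xs ys →
    ∑ xs f * ∑ ys g ≈ (∑[ x ∈ xs ] ∑[ y ∈ ys ] (f x * g y))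
  ∑-product f g xs ys = ≈-trans (∑-*ʳ _ f xs) (∑-cong xs (λ x → ∑-*ˡ (f x) g ys))

  ∑-layers : ∀ {m} (xs : List ℕ) (L : ℕ → List (Vec ℕ m)) (h : Vec ℕ (suc m) → Carrier) →
    ∑ (concatMap (λ k → map (k ∷_) (L k)) xs) h ≈ (∑[ k ∈ xs ] ∑[ u ∈ L k ] h (k ∷ u))
  ∑-layers xs L h = ≈-trans (∑-concatMap h _ xs) (∑-cong xs (λ k → reflexive (∑-map (k ∷_) h (L k))))

  -- ∑< N h = h 0 + ⋯ + h (N - 1): sums over 'upTo N' reduce to this form,
  -- which is convenient for induction on N.
  ∑< : ℕ → (ℕ → Carrier) → Carrier
  ∑< zero    h = 0#
  ∑< (suc N) h = h 0 + ∑< N (h ∘ suc)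

  ∑-applyUpTo : ∀ (h : ℕ → Carrier) f N → ∑ (applyUpTo f N) h ≡ ∑< N (h ∘ f)
  ∑-applyUpTo h f zero    = refl
  ∑-applyUpTo h f (suc N) = cong (h (f 0) +_) (∑-applyUpTo h (f ∘ suc) N)

  ∑-upTo : ∀ N (h : ℕ → Carrier) → ∑ (upTo N) h ≡ ∑< N h
  ∑-upTo N h = ∑-applyUpTo h (λ k → k) N

  ∑<-cong : ∀ {h g} N → (∀ k → k < N → h k ≈ g k) → ∑< N h ≈ ∑< N g
  ∑<-cong zero    h≈g = ≈-refl
  ∑<-cong (suc N) h≈g = +-cong (h≈g 0 (s≤s z≤n)) (∑<-cong N (λ k k<N → h≈g (suc k) (s≤s k<N)))

  ∑<-zero : ∀ {h} N → (∀ k → k < N → h k ≈ 0#) → ∑< N h ≈ 0#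
  ∑<-zero zero    h≈0 = ≈-refl
  ∑<-zero (suc N) h≈0 =
    ≈-trans (+-cong (h≈0 0 (s≤s z≤n)) (∑<-zero N (λ k k<N → h≈0 (suc k) (s≤s k<N)))) (+-identityˡ 0#)

  ∑<-pick : ∀ {h} N a → a < N → (∀ k → k < N → k ≢ a → h k ≈ 0#) → ∑< N h ≈ h a
  ∑<-pick (suc N) zero    _          off =
    ≈-trans (+-congˡ (∑<-zero N (λ k k<N → off (suc k) (s≤s k<N) (λ ())))) (+-identityʳ _)
  ∑<-pick (suc N) (suc a) (s≤s a<N) off =
    ≈-trans (+-cong (off 0 (s≤s z≤n) (λ ())) (∑<-pick N a a<N off′)) (+-identityˡ _)
    where
      off′ : ∀ k → k < N → k ≢ a → _
      off′ k k<N k≢a = off (suc k) (s≤s k<N) (λ eq → k≢a (ℕₚ.suc-injective eq))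

  ∑<-+ : ∀ f g N → ∑< N (λ k → f k + g k) ≈ ∑< N f + ∑< N g
  ∑<-+ f g zero    = ≈-sym (+-identityˡ 0#)
  ∑<-+ f g (suc N) = ≈-trans (+-congˡ (∑<-+ (f ∘ suc) (g ∘ suc) N)) (+-interchange _ _ _ _)

  ∑<-snoc : ∀ h N → ∑< (suc N) h ≈ ∑< N h + h N
  ∑<-snoc h zero    = ≈-trans (+-identityʳ _) (≈-sym (+-identityˡ _))
  ∑<-snoc h (suc N) = ≈-trans (+-congˡ (∑<-snoc (h ∘ suc) N)) (≈-sym (+-assoc _ _ _))

  -- δℕ a b and δ a b are the Kronecker deltas on ℕ and on exponent vectors:
  -- δ a b is the coefficient of the monomial x^b in x^a.  δℕ is opaque, so it
  -- is only ever used through δℕ-keep and δℕ-kill below.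
  opaque
    δℕ : ℕ → ℕ → Carrier
    δℕ a b = if does (a ℕ.≟ b) then 1# else 0#

    δℕ-≡ : ∀ {a b} → a ≡ b → δℕ a b ≡ 1#
    δℕ-≡ {a} refl rewrite dec-true (a ℕ.≟ a) refl = refl

    δℕ-≢ : ∀ {a b} → a ≢ b → δℕ a b ≡ 0#
    δℕ-≢ {a} {b} a≢b rewrite dec-false (a ℕ.≟ b) a≢b = refl

  δℕ-keep : ∀ {a b} x → a ≡ b → δℕ a b * x ≈ x
  δℕ-keep x a≡b = ≈-trans (*-congʳ (reflexive (δℕ-≡ a≡b))) (*-identityˡ x)

  δℕ-kill : ∀ {a b} x → a ≢ b → δℕ a b * x ≈ 0#
  δℕ-kill x a≢b = ≈-trans (*-congʳ (reflexive (δℕ-≢ a≢b))) (zeroˡ x)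

  δℕ-subst : ∀ a k (f : ℕ → Carrier) → δℕ a k * f k ≈ δℕ a k * f a
  δℕ-subst a k f with a ℕ.≟ k
  ... | yes refl = ≈-refl
  ... | no  a≢k  = ≈-trans (δℕ-kill _ a≢k) (≈-sym (δℕ-kill _ a≢k))

  δ : ∀ {m} → Vec ℕ m → Vec ℕ m → Carrier
  δ []       []       = 1#
  δ (a ∷ as) (b ∷ bs) = δℕ a b * δ as bs

  δ-≡ : ∀ {m} {a b : Vec ℕ m} → a ≡ b → δ a b ≈ 1#
  δ-≡ {a = []}     refl = ≈-refl
  δ-≡ {a = a ∷ as} refl = ≈-trans (δℕ-keep {a} (δ as as) refl) (δ-≡ {a = as} refl)

  δ-≢ : ∀ {m} (a b : Vec ℕ m) → a ≢ b → δ a b ≈ 0#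
  δ-≢ []       []       a≢b = ⊥-elim (a≢b refl)
  δ-≢ (a ∷ as) (b ∷ bs) a≢b with a ℕ.≟ b
  ... | yes refl = ≈-trans (*-congˡ (δ-≢ as bs (a≢b ∘ cong (a ∷_)))) (zeroʳ _)
  ... | no  a≢b₀ = δℕ-kill _ a≢b₀

  δ-transport : ∀ {m m′} (a b : Vec ℕ m) (a′ b′ : Vec ℕ m′) →
    (a ≡ b → a′ ≡ b′) → (a′ ≡ b′ → a ≡ b) → δ a b ≈ δ a′ b′
  δ-transport a b a′ b′ there back with Vecₚ.≡-dec ℕ._≟_ a b
  ... | yes a≡b = ≈-trans (δ-≡ a≡b) (≈-sym (δ-≡ (there a≡b)))
  ... | no  a≢b = ≈-trans (δ-≢ a b a≢b) (≈-sym (δ-≢ a′ b′ (a≢b ∘ back)))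

  rotate : ∀ x y z → x * (y * z) ≈ z * (x * y)
  rotate x y z = ≈-trans (≈-sym (*-assoc x y z)) (*-comm _ z)

  sgn : ℕ → Carrier
  sgn = signPow R

  sgn-+ : ∀ a b → sgn (a ℕ.+ b) ≈ sgn a * sgn b
  sgn-+ zero    b = ≈-sym (*-identityˡ _)
  sgn-+ (suc a) b = ≈-trans (-‿cong (sgn-+ a b)) (-‿distribˡ-* _ _)

  oneS≈δ : ∀ {m} (e : Vec ℕ m) → oneS R e ≈ δ 0ᵥ e
  oneS≈δ []          = ≈-refl
  oneS≈δ (zero ∷ e)  = ≈-trans (oneS≈δ e) (≈-sym (δℕ-keep _ refl))
  oneS≈δ (suc _ ∷ e) = ≈-sym (δℕ-kill _ (λ ()))

  var≈δ : ∀ {m} (i : Fin m) (e : Vec ℕ m) → var R i e ≈ δ (𝐞 i) e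
  var≈δ zero    (zero ∷ e)        = ≈-sym (δℕ-kill _ (λ ()))
  var≈δ zero    (suc zero ∷ e)    = ≈-trans (oneS≈δ e) (≈-sym (δℕ-keep _ refl))
  var≈δ zero    (suc (suc _) ∷ e) = ≈-sym (δℕ-kill _ (λ ()))
  var≈δ (suc i) (zero ∷ e)        = ≈-trans (var≈δ i e) (≈-sym (δℕ-keep _ refl))
  var≈δ (suc i) (suc _ ∷ e)       = ≈-sym (δℕ-kill _ (λ ()))

  ∑<-split-δℕ : ∀ a₀ b₀ x₀ D →
    ∑< (suc x₀) (λ p → (δℕ a₀ p * δℕ b₀ (x₀ ℕ.∸ p)) * D) ≈ δℕ (a₀ ℕ.+ b₀) x₀ * D
  ∑<-split-δℕ a₀ b₀ x₀ D with (a₀ ℕ.+ b₀) ℕ.≟ x₀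
  ... | yes refl = ≈-trans (∑<-pick (suc x₀) a₀ (s≤s (ℕₚ.m≤m+n a₀ b₀)) off) (≈-trans at-a₀ (≈-sym (δℕ-keep D refl)))
    where
      off : ∀ p → p < suc (a₀ ℕ.+ b₀) → p ≢ a₀ → (δℕ a₀ p * δℕ b₀ (a₀ ℕ.+ b₀ ℕ.∸ p)) * D ≈ 0#
      off p _ p≢a₀ = ≈-trans (*-congʳ (δℕ-kill _ (p≢a₀ ∘ ≡.sym))) (zeroˡ D)
      at-a₀ : (δℕ a₀ a₀ * δℕ b₀ (a₀ ℕ.+ b₀ ℕ.∸ a₀)) * D ≈ D
      at-a₀ = ≈-trans (*-congʳ (δℕ-keep {a₀} _ refl)) (δℕ-keep D (≡.sym (ℕₚ.m+n∸m≡n a₀ b₀)))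
  ... | no a₀+b₀≢x₀ = ≈-trans (∑<-zero (suc x₀) vanish) (≈-sym (δℕ-kill D a₀+b₀≢x₀))
    where
      vanish : ∀ p → p < suc x₀ → (δℕ a₀ p * δℕ b₀ (x₀ ℕ.∸ p)) * D ≈ 0#
      vanish p (s≤s p≤x₀) with a₀ ℕ.≟ p
      ... | no  a₀≢p = ≈-trans (*-congʳ (δℕ-kill _ a₀≢p)) (zeroˡ D)
      ... | yes refl = ≈-trans (*-congʳ (≈-trans (*-comm _ _) (δℕ-kill _ b₀≢x₀∸a₀))) (zeroˡ D)
        where
          b₀≢x₀∸a₀ : b₀ ≢ x₀ ℕ.∸ a₀
          b₀≢x₀∸a₀ eq = a₀+b₀≢x₀ (≡.trans (cong (a₀ ℕ.+_) eq) (ℕₚ.m+[n∸m]≡n p≤x₀))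

  -- All exponents: the splittings x = p ⊕ q in the definition of mulS hit
  -- (a, b) exactly when a ⊕ b = x, i.e. x^a · x^b = x^{a ⊕ b}.
  ∑-splits-δ : ∀ {m} (a b x : Vec ℕ m) →
    ∑[ pq ∈ splits x ] (δ a (proj₁ pq) * δ b (proj₂ pq)) ≈ δ (a ⊕ b) x
  ∑-splits-δ []       []       []       = ≈-trans (+-identityʳ _) (*-identityˡ 1#)
  ∑-splits-δ (a₀ ∷ a) (b₀ ∷ b) (x₀ ∷ x) = begin
    ∑ (concatMap layer (upTo (suc x₀))) H  ≈⟨ ∑-concatMap H layer (upTo (suc x₀)) ⟩
    ∑[ p ∈ upTo (suc x₀) ] ∑ (layer p) H  ≡⟨ ∑-upTo (suc x₀) _ ⟩
    ∑< (suc x₀) (λ p → ∑ (layer p) H)     ≈⟨ ∑<-cong (suc x₀) (λ p _ → factor p) ⟩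
    ∑< (suc x₀) (λ p → (δℕ a₀ p * δℕ b₀ (x₀ ℕ.∸ p)) * δ (a ⊕ b) x)
                                            ≈⟨ ∑<-split-δℕ a₀ b₀ x₀ _ ⟩
    δℕ (a₀ ℕ.+ b₀) x₀ * δ (a ⊕ b) x         ∎
    where
      H : Vec ℕ _ × Vec ℕ _ → Carrier
      H pq = δ (a₀ ∷ a) (proj₁ pq) * δ (b₀ ∷ b) (proj₂ pq)
      layer : ℕ → List (Vec ℕ _ × Vec ℕ _)
      layer p = map (λ { (u , v) → (p ∷ u , (x₀ ℕ.∸ p) ∷ v) }) (splits x)
      factor : ∀ p → ∑ (layer p) H ≈ (δℕ a₀ p * δℕ b₀ (x₀ ℕ.∸ p)) * δ (a ⊕ b) x
      factor p = begin
        ∑ (layer p) H ≡⟨ ∑-map _ H (splits x) ⟩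
        ∑[ uv ∈ splits x ] ((δℕ a₀ p * δ a (proj₁ uv)) * (δℕ b₀ (x₀ ℕ.∸ p) * δ b (proj₂ uv)))
          ≈⟨ ∑-cong (splits x) (λ _ → *-interchange _ _ _ _) ⟩
        ∑[ uv ∈ splits x ] ((δℕ a₀ p * δℕ b₀ (x₀ ℕ.∸ p)) * (δ a (proj₁ uv) * δ b (proj₂ uv)))
          ≈⟨ ∑-*ˡ _ _ (splits x) ⟨
        (δℕ a₀ p * δℕ b₀ (x₀ ℕ.∸ p)) * ∑[ uv ∈ splits x ] (δ a (proj₁ uv) * δ b (proj₂ uv))
          ≈⟨ *-congˡ (∑-splits-δ a b x) ⟩
        (δℕ a₀ p * δℕ b₀ (x₀ ℕ.∸ p)) * δ (a ⊕ b) x ∎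

  mulS-cong : ∀ {m} {f f′ g g′ : Series R m} →
    (∀ y → f y ≈ f′ y) → (∀ y → g y ≈ g′ y) → ∀ x → mulS R f g x ≈ mulS R f′ g′ x
  mulS-cong f≈f′ g≈g′ x = ∑-cong (splits x) (λ pq → *-cong (f≈f′ (proj₁ pq)) (g≈g′ (proj₂ pq)))

  powS-cong : ∀ {m} {f f′ : Series R m} → (∀ y → f y ≈ f′ y) → ∀ k x → powS R f k x ≈ powS R f′ k x
  powS-cong f≈f′ zero    x = ≈-refl
  powS-cong f≈f′ (suc k) x = mulS-cong f≈f′ (powS-cong f≈f′ k) x

  prodS-cong : ∀ {r m} {L L′ : Fin r → Series R m} →
    (∀ i y → L i y ≈ L′ i y) → ∀ x → prodS R L x ≈ prodS R L′ x
  prodS-cong {zero}  L≈L′ x = ≈-refl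
  prodS-cong {suc r} L≈L′ x = mulS-cong (L≈L′ zero) (prodS-cong (λ i → L≈L′ (suc i))) x

  mulS-monomial : ∀ {m} c d (a b x : Vec ℕ m) →
    mulS R (λ y → c * δ a y) (λ y → d * δ b y) x ≈ (c * d) * δ (a ⊕ b) x
  mulS-monomial c d a b x = begin
    ∑[ pq ∈ splits x ] ((c * δ a (proj₁ pq)) * (d * δ b (proj₂ pq)))
      ≈⟨ ∑-cong (splits x) (λ _ → *-interchange c _ d _) ⟩
    ∑[ pq ∈ splits x ] ((c * d) * (δ a (proj₁ pq) * δ b (proj₂ pq)))
      ≈⟨ ∑-*ˡ _ _ (splits x) ⟨
    (c * d) * ∑[ pq ∈ splits x ] (δ a (proj₁ pq) * δ b (proj₂ pq))
      ≈⟨ *-congˡ (∑-splits-δ a b x) ⟩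
    (c * d) * δ (a ⊕ b) x ∎

  powS-negδ : ∀ {m} (a : Vec ℕ m) k x → powS R (λ y → - δ a y) k x ≈ sgn k * δ (k ⊙ a) x
  powS-negδ a zero    x = ≈-trans (oneS≈δ x) (≈-sym (≈-trans (*-identityˡ _) (reflexive (cong (λ v → δ v x) (0⊙ a)))))
  powS-negδ a (suc k) x = begin
    mulS R (λ y → - δ a y) (powS R (λ y → - δ a y) k) x
      ≈⟨ mulS-cong (λ y → ≈-sym (-1*x≈-x _)) (powS-negδ a k) x ⟩
    mulS R (λ y → - 1# * δ a y) (λ y → sgn k * δ (k ⊙ a) y) x
      ≈⟨ mulS-monomial (- 1#) (sgn k) a (k ⊙ a) x ⟩
    (- 1# * sgn k) * δ (a ⊕ k ⊙ a) x
      ≈⟨ *-cong (-1*x≈-x _) (reflexive (cong (λ v → δ v x) (≡.sym (suc⊙ k a)))) ⟩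
    sgn (suc k) * δ (suc k ⊙ a) x ∎

  prodS-negVars : ∀ {r m} (ι : Fin r → Fin m) (u : Vec ℕ r) x →
    prodS R (λ i → powS R (negS R (var R (ι i))) (lookup u i)) x ≈ sgn (deg u) * δ (lincomb (𝐞 ∘ ι) u) x
  prodS-negVars ι u x =
    ≈-trans (prodS-cong (λ i → powS-cong (λ y → -‿cong (var≈δ (ι i) y)) (lookup u i)) x) (negδs (𝐞 ∘ ι) u x)
    where
      negδs : ∀ {r} (α : Fin r → Vec ℕ _) (u : Vec ℕ r) x →
        prodS R (λ i → powS R (λ y → - δ (α i) y) (lookup u i)) x ≈ sgn (deg u) * δ (lincomb α u) x
      negδs α []       x = ≈-trans (oneS≈δ x) (≈-sym (*-identityˡ _))
      negδs α (u₀ ∷ u) x =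
        ≈-trans (mulS-cong (powS-negδ (α zero) u₀) (negδs (α ∘ suc) u) x)
                (≈-trans (mulS-monomial _ _ (u₀ ⊙ α zero) (lincomb (α ∘ suc) u) x) (*-congʳ (≈-sym (sgn-+ u₀ (deg u)))))

  monomials : ∀ {m} {A : Set} → List A → (A → Carrier) → (A → Vec ℕ m) → Series R m
  monomials J c α y = ∑[ j ∈ J ] (c j * δ (α j) y)

  mulS-monomials : ∀ {m} {A B : Set} (J : List A) (K : List B)
    (c : A → Carrier) (α : A → Vec ℕ m) (d : B → Carrier) (β : B → Vec ℕ m) x →
    mulS R (monomials J c α) (monomials K d β) x ≈ (∑[ j ∈ J ] ∑[ l ∈ K ] ((c j * d l) * δ (α j ⊕ β l) x))
  mulS-monomials J K c α d β x = begin
    ∑[ pq ∈ splits x ] (monomials J c α (proj₁ pq) * monomials K d β (proj₂ pq))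
      ≈⟨ ∑-cong (splits x) (λ pq → ∑-product _ _ J K) ⟩
    ∑[ pq ∈ splits x ] ∑[ j ∈ J ] ∑[ l ∈ K ] term j l pq
      ≈⟨ ∑-swap (λ pq j → ∑[ l ∈ K ] term j l pq) (splits x) J ⟩
    ∑[ j ∈ J ] ∑[ pq ∈ splits x ] ∑[ l ∈ K ] term j l pq
      ≈⟨ ∑-cong J (λ j → ∑-swap (λ pq l → term j l pq) (splits x) K) ⟩
    ∑[ j ∈ J ] ∑[ l ∈ K ] mulS R (λ y → c j * δ (α j) y) (λ y → d l * δ (β l) y) x
      ≈⟨ ∑-cong J (λ j → ∑-cong K (λ l → mulS-monomial (c j) (d l) (α j) (β l) x)) ⟩
    ∑[ j ∈ J ] ∑[ l ∈ K ] ((c j * d l) * δ (α j ⊕ β l) x) ∎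
    where
      term : _ → _ → Vec ℕ _ × Vec ℕ _ → Carrier
      term j l pq = (c j * δ (α j) (proj₁ pq)) * (d l * δ (β l) (proj₂ pq))

  -- binom± k a is the coefficient of x^{binomExp v w k a} in (x^v − x^w)^k.
  binom± : ℕ → ℕ → Carrier
  binom± k a = natCast R (k C a) * sgn a

  natCast-+ : ∀ a b → natCast R (a ℕ.+ b) ≈ natCast R a + natCast R b
  natCast-+ zero    b = ≈-sym (+-identityˡ _)
  natCast-+ (suc a) b = ≈-trans (+-congˡ (natCast-+ a b)) (≈-sym (+-assoc _ _ _))

  binom±-pascal : ∀ k a → binom± (suc k) (suc a) ≈ binom± k (suc a) + natCast R (k C a) * sgn (suc a)
  binom±-pascal k a = begin
    natCast R (suc k C suc a) * sgn (suc a)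
      ≡⟨ cong (λ n → natCast R n * sgn (suc a)) (≡.sym (nCk+nC[k+1]≡[n+1]C[k+1] k a)) ⟩
    natCast R (k C a ℕ.+ k C suc a) * sgn (suc a)
      ≈⟨ *-congʳ (≈-trans (natCast-+ (k C a) (k C suc a)) (+-comm _ _)) ⟩
    (natCast R (k C suc a) + natCast R (k C a)) * sgn (suc a)
      ≈⟨ distribʳ _ _ _ ⟩
    binom± k (suc a) + natCast R (k C a) * sgn (suc a) ∎

  ±1 : Bool → Carrier
  ±1 true  = 1#
  ±1 false = - 1#

  v-or-w : ∀ {m} → Vec ℕ m → Vec ℕ m → Bool → Vec ℕ m
  v-or-w v w true  = v
  v-or-w v w false = w

  difference≈monomials : ∀ {m} (v w y : Vec ℕ m) →
    δ v y + - δ w y ≈ monomials (true ∷ false ∷ []) ±1 (v-or-w v w) y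
  difference≈monomials v w y =
    ≈-sym (≈-trans (+-cong (*-identityˡ _) (≈-trans (+-identityʳ _) (-1*x≈-x _))) ≈-refl)

  -- Multiplying the expansion of (x^v − x^w)^k by x^v − x^w: the inductive step
  -- of the binomial theorem, where Pascal's rule combines the two products.
  binomial-step : ∀ {m} (v w : Vec ℕ m) k x →
    mulS R (λ y → δ v y + - δ w y) (λ y → ∑< (suc k) (λ a → binom± k a * δ (binomExp v w k a) y)) x
      ≈ ∑< (suc (suc k)) (λ a → binom± (suc k) a * δ (binomExp v w (suc k) a) x)
  binomial-step v w k x = begin
    mulS R (λ y → δ v y + - δ w y) (λ y → ∑< (suc k) (λ a → binom± k a * δ (binomExp v w k a) y)) x
      ≈⟨ mulS-cong (difference≈monomials v w) (λ y → reflexive (≡.sym (∑-upTo (suc k) _))) x ⟩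
    mulS R (monomials (true ∷ false ∷ []) ±1 (v-or-w v w)) (monomials (upTo (suc k)) (binom± k) (binomExp v w k)) x
      ≈⟨ mulS-monomials (true ∷ false ∷ []) (upTo (suc k)) ±1 (v-or-w v w) (binom± k) (binomExp v w k) x ⟩
    ∑ (upTo (suc k)) (U true) + (∑ (upTo (suc k)) (U false) + 0#)
      ≈⟨ +-cong (reflexive (∑-upTo (suc k) _)) (≈-trans (+-identityʳ _) (reflexive (∑-upTo (suc k) _))) ⟩
    ∑< (suc k) (U true) + ∑< (suc k) (U false)
      ≈⟨ +-cong (≈-sym from-v) (≈-sym from-w) ⟩
    ∑< (suc (suc k)) T₁ + ∑< (suc (suc k)) T₂
      ≈⟨ ∑<-+ T₁ T₂ (suc (suc k)) ⟨
    ∑< (suc (suc k)) (λ a → T₁ a + T₂ a)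
      ≈⟨ ∑<-cong (suc (suc k)) (λ a _ → ≈-sym (pascal a)) ⟩
    ∑< (suc (suc k)) T ∎
    where
      U : Bool → ℕ → Carrier
      U b a = (±1 b * binom± k a) * δ (v-or-w v w b ⊕ binomExp v w k a) x
      T T₁ T₂ : ℕ → Carrier
      T  a = binom± (suc k) a * δ (binomExp v w (suc k) a) x
      T₁ a = binom± k a * δ (binomExp v w (suc k) a) x
      T₂ zero    = 0#
      T₂ (suc a) = (natCast R (k C a) * sgn (suc a)) * δ (binomExp v w (suc k) (suc a)) x
      -- each new coefficient collects one term from x^v·(…) and one from −x^w·(…)
      pascal : ∀ a → T a ≈ T₁ a + T₂ a
      pascal zero    = ≈-sym (+-identityʳ _)
      pascal (suc a) = ≈-trans (*-congʳ (binom±-pascal k a)) (distribʳ _ _ _)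
      -- the terms x^v·(…): the top coefficient C(k, k+1) vanishes
      from-v : ∑< (suc (suc k)) T₁ ≈ ∑< (suc k) (U true)
      from-v = begin
        ∑< (suc (suc k)) T₁          ≈⟨ ∑<-snoc T₁ (suc k) ⟩
        ∑< (suc k) T₁ + T₁ (suc k)   ≈⟨ +-congˡ top-vanishes ⟩
        ∑< (suc k) T₁ + 0#           ≈⟨ +-identityʳ _ ⟩
        ∑< (suc k) T₁                ≈⟨ ∑<-cong (suc k) (λ a a<1+k → ≈-sym (*-cong (*-identityˡ (binom± k a))
                                          (reflexive (cong (λ z → δ z x) (⊕-binomExp-v v w k a (ℕₚ.≤-pred a<1+k)))))) ⟩
        ∑< (suc k) (U true)          ∎
        where
          top-vanishes : T₁ (suc k) ≈ 0#
          top-vanishes = ≈-trans (*-congʳ (*-congʳ (reflexive (cong (natCast R) (k>n⇒nCk≡0 (ℕₚ.n<1+n k))))))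
                                 (≈-trans (*-congʳ (zeroˡ _)) (zeroˡ _))
      -- the terms −x^w·(…): shifting the index by one
      from-w : ∑< (suc (suc k)) T₂ ≈ ∑< (suc k) (U false)
      from-w = ≈-trans (+-identityˡ _) (∑<-cong (suc k) (λ a _ → ≈-sym (*-cong
                 (≈-trans (-1*x≈-x _) (-‿distribʳ-* (natCast R (k C a)) (sgn a)))
                 (reflexive (cong (λ z → δ z x) (⊕-binomExp-w v w k a))))))

  binomial : ∀ {m} (v w : Vec ℕ m) k x →
    powS R (λ y → δ v y + - δ w y) k x ≈ ∑< (suc k) (λ a → binom± k a * δ (binomExp v w k a) x)
  binomial v w zero    x =
    ≈-trans (oneS≈δ x) (≈-sym (≈-trans (+-identityʳ _) (≈-trans (*-congʳ (≈-trans (*-identityʳ _) (+-identityʳ 1#)))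
      (≈-trans (*-identityˡ _) (reflexive (cong (λ z → δ z x) zero-exponent))))))
    where
      zero-exponent : binomExp v w 0 0 ≡ 0ᵥ
      zero-exponent = ≡.trans (cong₂ _⊕_ (0⊙ w) (0⊙ v)) (0ᵥ⊕ 0ᵥ)
  binomial v w (suc k) x =
    ≈-trans (mulS-cong (λ _ → ≈-refl) (binomial v w k) x) (binomial-step v w k x)

  binomWeight : ∀ {r} → Vec ℕ r → Vec ℕ r → Carrier
  binomWeight []       []       = 1#
  binomWeight (t₀ ∷ t) (a₀ ∷ a) = binom± t₀ a₀ * binomWeight t a

  prodS-binomials : ∀ {r m} (v : Fin r → Vec ℕ m) (w : Vec ℕ m) (t : Vec ℕ r) x →
    prodS R (λ i → powS R (λ y → δ (v i) y + - δ w y) (lookup t i)) x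
      ≈ monomials (below t) (binomWeight t) (binomExps v w t) x
  prodS-binomials v w []       x = ≈-trans (oneS≈δ x) (≈-sym (≈-trans (+-identityʳ _) (*-identityˡ _)))
  prodS-binomials v w (t₀ ∷ t) x = begin
    prodS R (λ i → powS R (λ y → δ (v i) y + - δ w y) (lookup (t₀ ∷ t) i)) x
      ≈⟨ mulS-cong (λ y → ≈-trans (binomial (v zero) w t₀ y) (reflexive (≡.sym (∑-upTo (suc t₀) _))))
                   (prodS-binomials (v ∘ suc) w t) x ⟩
    mulS R (monomials (upTo (suc t₀)) (binom± t₀) (binomExp (v zero) w t₀))
           (monomials (below t) (binomWeight t) (binomExps (v ∘ suc) w t)) x
      ≈⟨ mulS-monomials (upTo (suc t₀)) (below t) _ (binomExp (v zero) w t₀) _ (binomExps (v ∘ suc) w t) x ⟩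
    (∑[ a₀ ∈ upTo (suc t₀) ] ∑[ a ∈ below t ] h (a₀ ∷ a))
      ≈⟨ ∑-layers (upTo (suc t₀)) (λ _ → below t) h ⟨
    monomials (below (t₀ ∷ t)) (binomWeight (t₀ ∷ t)) (binomExps v w (t₀ ∷ t)) x ∎
    where
      h : Vec ℕ _ → Carrier
      h a = binomWeight (t₀ ∷ t) a * δ (binomExps v w (t₀ ∷ t) a) x

  shift-coefficient : ∀ {r} n (e t : Vec ℕ r) →
    prodS R (λ i → powS R (addS R (var R (suc i)) (negS R (var R zero))) (lookup t i)) (n ∷ e)
      ≈ (∑[ a ∈ below t ] (binomWeight t a * (δℕ (deg a) n * δ (t ⊖ a) e)))
  shift-coefficient n e t = begin
    prodS R (λ i → powS R (addS R (var R (suc i)) (negS R (var R zero))) (lookup t i)) (n ∷ e)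
      ≈⟨ prodS-cong (λ i → powS-cong (λ y → +-cong (var≈δ (suc i) y) (-‿cong (var≈δ zero y))) (lookup t i)) (n ∷ e) ⟩
    prodS R (λ i → powS R (λ y → δ (𝐞 (suc i)) y + - δ (𝐞 zero) y) (lookup t i)) (n ∷ e)
      ≈⟨ prodS-binomials (𝐞 ∘ suc) (𝐞 zero) t (n ∷ e) ⟩
    monomials (below t) (binomWeight t) (binomExps (𝐞 ∘ suc) (𝐞 zero) t) (n ∷ e)
      ≈⟨ ∑-cong (below t) (λ a → *-congˡ (reflexive (cong (λ z → δ z (n ∷ e)) (binomExps-XY t a)))) ⟩
    (∑[ a ∈ below t ] (binomWeight t a * (δℕ (deg a) n * δ (t ⊖ a) e))) ∎

  ∑-comps-suc : ∀ {m} d (h : Vec ℕ (suc m) → Carrier) →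
    ∑ (comps (suc m) d) h ≈ ∑< (suc d) (λ k → ∑[ u ∈ comps m (d ℕ.∸ k) ] h (k ∷ u))
  ∑-comps-suc {m} d h =
    ≈-trans (∑-layers (upTo (suc d)) (λ k → comps m (d ℕ.∸ k)) h) (reflexive (∑-upTo (suc d) _))

  ∑-below-∷ : ∀ {r} t₀ (t : Vec ℕ r) (h : Vec ℕ (suc r) → Carrier) →
    ∑ (below (t₀ ∷ t)) h ≈ ∑< (suc t₀) (λ a₀ → ∑[ a ∈ below t ] h (a₀ ∷ a))
  ∑-below-∷ t₀ t h = ≈-trans (∑-layers (upTo (suc t₀)) (λ _ → below t) h) (reflexive (∑-upTo (suc t₀) _))

  comps-cong : ∀ {m} d {f g : Vec ℕ m → Carrier} →
    (∀ u → deg u ≡ d → f u ≈ g u) → ∑ (comps m d) f ≈ ∑ (comps m d) g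
  comps-cong {zero}  zero    f≈g = +-congʳ (f≈g [] refl)
  comps-cong {zero}  (suc d) f≈g = ≈-refl
  comps-cong {suc m} d {f} {g} f≈g = begin
    ∑ (comps (suc m) d) f
      ≈⟨ ∑-comps-suc d f ⟩
    ∑< (suc d) (λ k → ∑[ u ∈ comps m (d ℕ.∸ k) ] f (k ∷ u))
      ≈⟨ ∑<-cong (suc d) (λ k k≤d → comps-cong (d ℕ.∸ k) (layer k k≤d)) ⟩
    ∑< (suc d) (λ k → ∑[ u ∈ comps m (d ℕ.∸ k) ] g (k ∷ u))
      ≈⟨ ∑-comps-suc d g ⟨
    ∑ (comps (suc m) d) g ∎
    where
      layer : ∀ k → k < suc d → ∀ u → deg u ≡ d ℕ.∸ k → f (k ∷ u) ≈ g (k ∷ u)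
      layer k (s≤s k≤d) u |u|≡d∸k = f≈g (k ∷ u) (≡.trans (cong (k ℕ.+_) |u|≡d∸k) (ℕₚ.m+[n∸m]≡n k≤d))

  comps-δ : ∀ {m} d (v : Vec ℕ m) (g : Vec ℕ m → Carrier) →
    ∑[ u ∈ comps m d ] (δ v u * g u) ≈ δℕ (deg v) d * g v
  comps-δ {zero}  zero    [] g = ≈-trans (+-identityʳ _) (≈-trans (*-identityˡ _) (≈-sym (δℕ-keep _ refl)))
  comps-δ {zero}  (suc d) [] g = ≈-sym (δℕ-kill _ (λ ()))
  comps-δ {suc m} d (v₀ ∷ v) g = begin
    ∑[ u ∈ comps (suc m) d ] (δ (v₀ ∷ v) u * g u)
      ≈⟨ ∑-comps-suc {m} d (λ u → δ (v₀ ∷ v) u * g u) ⟩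
    ∑< (suc d) (λ k → ∑[ u ∈ comps m (d ℕ.∸ k) ] ((δℕ v₀ k * δ v u) * g (k ∷ u)))
      ≈⟨ ∑<-cong (suc d) (λ k _ → peel k) ⟩
    ∑< (suc d) (λ k → (δℕ v₀ k * δℕ (deg v) (d ℕ.∸ k)) * g (v₀ ∷ v))
      ≈⟨ ∑<-split-δℕ v₀ (deg v) d _ ⟩
    δℕ (v₀ ℕ.+ deg v) d * g (v₀ ∷ v) ∎
    where
      peel : ∀ k → ∑[ u ∈ comps m (d ℕ.∸ k) ] ((δℕ v₀ k * δ v u) * g (k ∷ u))
                     ≈ (δℕ v₀ k * δℕ (deg v) (d ℕ.∸ k)) * g (v₀ ∷ v)
      peel k = begin
        ∑[ u ∈ comps m (d ℕ.∸ k) ] ((δℕ v₀ k * δ v u) * g (k ∷ u))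
          ≈⟨ ∑-cong (comps m (d ℕ.∸ k)) (λ u → *-assoc _ _ _) ⟩
        ∑[ u ∈ comps m (d ℕ.∸ k) ] (δℕ v₀ k * (δ v u * g (k ∷ u)))
          ≈⟨ ∑-*ˡ _ _ (comps m (d ℕ.∸ k)) ⟨
        δℕ v₀ k * ∑[ u ∈ comps m (d ℕ.∸ k) ] (δ v u * g (k ∷ u))
          ≈⟨ *-congˡ (comps-δ (d ℕ.∸ k) v (λ u → g (k ∷ u))) ⟩
        δℕ v₀ k * (δℕ (deg v) (d ℕ.∸ k) * g (k ∷ v))
          ≈⟨ δℕ-subst v₀ k (λ j → δℕ (deg v) (d ℕ.∸ k) * g (j ∷ v)) ⟩
        δℕ v₀ k * (δℕ (deg v) (d ℕ.∸ k) * g (v₀ ∷ v))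
          ≈⟨ *-assoc _ _ _ ⟨
        (δℕ v₀ k * δℕ (deg v) (d ℕ.∸ k)) * g (v₀ ∷ v) ∎

  comps-pick : ∀ {m} d (v : Vec ℕ m) (g : Vec ℕ m → Carrier) → deg v ≡ d →
    ∑[ u ∈ comps m d ] (δ v u * g u) ≈ g v
  comps-pick d v g |v|≡d = ≈-trans (comps-δ d v g) (δℕ-keep (g v) |v|≡d)

  comps-single : ∀ d (h : Vec ℕ 1 → Carrier) → ∑ (comps 1 d) h ≈ h (d ∷ [])
  comps-single d h = ≈-trans (comps-cong d insert-δ) (comps-pick d (d ∷ []) h (ℕₚ.+-identityʳ d))
    where
      insert-δ : ∀ u → deg u ≡ d → h u ≈ δ (d ∷ []) u * h u
      insert-δ (u₀ ∷ []) u₀+0≡d =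
        ≈-sym (≈-trans (*-congʳ (δ-≡ (cong (_∷ []) (≡.trans (≡.sym u₀+0≡d) (ℕₚ.+-identityʳ u₀))))) (*-identityˡ _))

  comps-reverse : ∀ {r} n (H : Vec ℕ r → Carrier) → ∑ (comps r n) H ≈ ∑[ k ∈ comps r n ] H (reverse k)
  comps-reverse {r} n H = ≈-sym (begin
    ∑[ k ∈ comps r n ] H (reverse k)
      ≈⟨ comps-cong n (λ k |k|≡n → ≈-sym (comps-pick n (reverse k) H (≡.trans (deg-reverse k) |k|≡n))) ⟩
    ∑[ k ∈ comps r n ] ∑[ j ∈ comps r n ] (δ (reverse k) j * H j)
      ≈⟨ ∑-swap (λ k j → δ (reverse k) j * H j) (comps r n) (comps r n) ⟩
    ∑[ j ∈ comps r n ] ∑[ k ∈ comps r n ] (δ (reverse k) j * H j)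
      ≈⟨ ∑-cong (comps r n) (λ j → ∑-cong (comps r n) (λ k → *-congʳ
           (δ-transport (reverse k) j (reverse j) k Vecₚ.reverse-reverse Vecₚ.reverse-reverse))) ⟩
    ∑[ j ∈ comps r n ] ∑[ k ∈ comps r n ] (δ (reverse j) k * H j)
      ≈⟨ comps-cong n (λ j |j|≡n → comps-pick n (reverse j) (λ _ → H j) (≡.trans (deg-reverse j) |j|≡n)) ⟩
    ∑ (comps r n) H ∎)

  ∑-below-δ-∷ : ∀ {r} t₀ e₀ (t e : Vec ℕ r) (g : Vec ℕ (suc r) → Carrier) →
    ∑[ a ∈ below (t₀ ∷ t) ] (δ ((t₀ ∷ t) ⊖ a) (e₀ ∷ e) * g a)
      ≈ ∑< (suc t₀) (λ a₀ → δℕ (t₀ ℕ.∸ a₀) e₀ * ∑[ a ∈ below t ] (δ (t ⊖ a) e * g (a₀ ∷ a)))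
  ∑-below-δ-∷ t₀ e₀ t e g =
    ≈-trans (∑-below-∷ t₀ t (λ a → δ ((t₀ ∷ t) ⊖ a) (e₀ ∷ e) * g a)) (∑<-cong (suc t₀) (λ a₀ _ → factor a₀))
    where
      factor : ∀ a₀ → ∑[ a ∈ below t ] ((δℕ (t₀ ℕ.∸ a₀) e₀ * δ (t ⊖ a) e) * g (a₀ ∷ a))
                        ≈ δℕ (t₀ ℕ.∸ a₀) e₀ * ∑[ a ∈ below t ] (δ (t ⊖ a) e * g (a₀ ∷ a))
      factor a₀ = ≈-trans (∑-cong (below t) (λ a → *-assoc _ _ _))
                          (≈-sym (∑-*ˡ (δℕ (t₀ ℕ.∸ a₀) e₀) (λ a → δ (t ⊖ a) e * g (a₀ ∷ a)) (below t)))

  below-pick : ∀ {r} (t e : Vec ℕ r) (g : Vec ℕ r → Carrier) → e ≤ᵥ t →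
    ∑[ a ∈ below t ] (δ (t ⊖ a) e * g a) ≈ g (t ⊖ e)
  below-pick []       []       g []            = ≈-trans (+-identityʳ _) (*-identityˡ _)
  below-pick (t₀ ∷ t) (e₀ ∷ e) g (e₀≤t₀ ∷ e≤t) = begin
    ∑[ a ∈ below (t₀ ∷ t) ] (δ ((t₀ ∷ t) ⊖ a) (e₀ ∷ e) * g a)  ≈⟨ ∑-below-δ-∷ t₀ e₀ t e g ⟩
    ∑< (suc t₀) layer                                        ≈⟨ ∑<-pick (suc t₀) (t₀ ℕ.∸ e₀) (s≤s (ℕₚ.m∸n≤m t₀ e₀)) off ⟩
    layer (t₀ ℕ.∸ e₀)                                        ≈⟨ δℕ-keep _ (ℕₚ.m∸[m∸n]≡n e₀≤t₀) ⟩
    ∑[ a ∈ below t ] (δ (t ⊖ a) e * g ((t₀ ℕ.∸ e₀) ∷ a))     ≈⟨ below-pick t e (λ a → g ((t₀ ℕ.∸ e₀) ∷ a)) e≤t ⟩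
    g ((t₀ ∷ t) ⊖ (e₀ ∷ e))                                  ∎
    where
      layer : ℕ → Carrier
      layer a₀ = δℕ (t₀ ℕ.∸ a₀) e₀ * ∑[ a ∈ below t ] (δ (t ⊖ a) e * g (a₀ ∷ a))
      off : ∀ a₀ → a₀ < suc t₀ → a₀ ≢ t₀ ℕ.∸ e₀ → layer a₀ ≈ 0#
      off a₀ (s≤s a₀≤t₀) a₀≢t₀∸e₀ =
        δℕ-kill _ (λ eq → a₀≢t₀∸e₀ (≡.trans (≡.sym (ℕₚ.m∸[m∸n]≡n a₀≤t₀)) (cong (t₀ ℕ.∸_) eq)))

  below-miss : ∀ {r} (t e : Vec ℕ r) (g : Vec ℕ r → Carrier) → ¬ (e ≤ᵥ t) →
    ∑[ a ∈ below t ] (δ (t ⊖ a) e * g a) ≈ 0#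
  below-miss []       []       g e≰t = ⊥-elim (e≰t [])
  below-miss (t₀ ∷ t) (e₀ ∷ e) g e≰t = ≈-trans (∑-below-δ-∷ t₀ e₀ t e g) (∑<-zero (suc t₀) vanish)
    where
      vanish : ∀ a₀ → a₀ < suc t₀ → δℕ (t₀ ℕ.∸ a₀) e₀ * ∑[ a ∈ below t ] (δ (t ⊖ a) e * g (a₀ ∷ a)) ≈ 0#
      vanish a₀ _ with e₀ ℕ.≤? t₀
      ... | yes e₀≤t₀ = ≈-trans (*-congˡ (below-miss t e _ (λ e≤t → e≰t (e₀≤t₀ ∷ e≤t)))) (zeroʳ _)
      ... | no  e₀≰t₀ = δℕ-kill _ (λ eq → e₀≰t₀ (subst (ℕ._≤ t₀) eq (ℕₚ.m∸n≤m t₀ a₀)))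

  -- For fixed t, the compositions k of n with e ⊕ k = t correspond to the
  -- indices a below t with |a| = n and t ⊖ a = e (both sides pick k = a = t ⊖ e).
  shift-fibre : ∀ {r} n (e t : Vec ℕ r) (F : Vec ℕ r → Vec ℕ r → Carrier) →
    ∑[ k ∈ comps r n ] (δ (e ⊕ k) t * F t k) ≈ ∑[ a ∈ below t ] (F t a * (δℕ (deg a) n * δ (t ⊖ a) e))
  shift-fibre {r} n e t F with Pointwise.decidable ℕ._≤?_ e t
  ... | yes e≤t = begin
    ∑[ k ∈ comps r n ] (δ (e ⊕ k) t * F t k)
      ≈⟨ ∑-cong (comps r n) (λ k → *-congʳ (δ-transport (e ⊕ k) t (t ⊖ e) k
           (λ eq → ≡.trans (cong (_⊖ e) (≡.sym eq)) (⊕⊖ e k))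
           (λ eq → ≡.trans (cong (e ⊕_) (≡.sym eq)) (⊕⊖-≤ e≤t)))) ⟩
    ∑[ k ∈ comps r n ] (δ (t ⊖ e) k * F t k)                      ≈⟨ comps-δ n (t ⊖ e) (F t) ⟩
    δℕ (deg (t ⊖ e)) n * F t (t ⊖ e)                              ≈⟨ *-comm _ _ ⟩
    F t (t ⊖ e) * δℕ (deg (t ⊖ e)) n                              ≈⟨ below-pick t e (λ a → F t a * δℕ (deg a) n) e≤t ⟨
    ∑[ a ∈ below t ] (δ (t ⊖ a) e * (F t a * δℕ (deg a) n))       ≈⟨ ∑-cong (below t) (λ a → ≈-sym (rotate _ _ _)) ⟩
    ∑[ a ∈ below t ] (F t a * (δℕ (deg a) n * δ (t ⊖ a) e))       ∎
  ... | no e≰t = ≈-trans (∑-zero (comps r n) vanish)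
                   (≈-sym (≈-trans (∑-cong (below t) (λ a → rotate _ _ _)) (below-miss t e _ e≰t)))
    where
      vanish : ∀ k → δ (e ⊕ k) t * F t k ≈ 0#
      vanish k = ≈-trans (*-congʳ (δ-≢ (e ⊕ k) t (λ eq → e≰t (subst (e ≤ᵥ_) eq (≤ᵥ-⊕ e k))))) (zeroˡ _)

  -- Reindexing by t = e ⊕ k: the double sum on the right-hand side of the
  -- theorem collapses to a sum over the compositions k of n.
  comps-shift : ∀ {r} n (e : Vec ℕ r) (F : Vec ℕ r → Vec ℕ r → Carrier) →
    (∑[ t ∈ comps r (n ℕ.+ deg e) ] ∑[ a ∈ below t ] (F t a * (δℕ (deg a) n * δ (t ⊖ a) e)))
      ≈ ∑[ k ∈ comps r n ] F (e ⊕ k) k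
  comps-shift {r} n e F = ≈-sym (begin
    ∑[ k ∈ comps r n ] F (e ⊕ k) k
      ≈⟨ comps-cong n (λ k |k|≡n → ≈-sym (comps-pick (n ℕ.+ deg e) (e ⊕ k) (λ t → F t k) (|e⊕k| k |k|≡n))) ⟩
    ∑[ k ∈ comps r n ] ∑[ t ∈ comps r (n ℕ.+ deg e) ] (δ (e ⊕ k) t * F t k)
      ≈⟨ ∑-swap (λ k t → δ (e ⊕ k) t * F t k) (comps r n) (comps r (n ℕ.+ deg e)) ⟩
    ∑[ t ∈ comps r (n ℕ.+ deg e) ] ∑[ k ∈ comps r n ] (δ (e ⊕ k) t * F t k)
      ≈⟨ ∑-cong (comps r (n ℕ.+ deg e)) (λ t → shift-fibre n e t F) ⟩
    (∑[ t ∈ comps r (n ℕ.+ deg e) ] ∑[ a ∈ below t ] (F t a * (δℕ (deg a) n * δ (t ⊖ a) e))) ∎)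
    where
      |e⊕k| : ∀ k → deg k ≡ n → deg (e ⊕ k) ≡ n ℕ.+ deg e
      |e⊕k| k |k|≡n = ≡.trans (deg-⊕ e k) (≡.trans (ℕₚ.+-comm (deg e) (deg k)) (cong (ℕ._+ deg e) |k|≡n))

  substS-negX : ∀ (F : Series R 1) n →
    substS R F (λ _ → negS R (var R zero)) (n ∷ []) ≈ F (n ∷ []) * sgn n
  substS-negX F n = begin
    ∑[ t ∈ comps 1 (n ℕ.+ 0) ] (F t * negX^ t)
      ≈⟨ comps-single (n ℕ.+ 0) (λ t → F t * negX^ t) ⟩
    F (n ℕ.+ 0 ∷ []) * negX^ (n ℕ.+ 0 ∷ [])
      ≡⟨ cong (λ d → F (d ∷ []) * negX^ (d ∷ [])) (ℕₚ.+-identityʳ n) ⟩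
    F (n ∷ []) * negX^ (n ∷ [])
      ≈⟨ *-congˡ (prodS-negVars (λ _ → zero) (n ∷ []) (n ∷ [])) ⟩
    F (n ∷ []) * (sgn (n ℕ.+ 0) * δ (lincomb (λ _ → 𝐞 zero) (n ∷ [])) (n ∷ []))
      ≈⟨ *-congˡ (*-cong (reflexive (cong sgn (ℕₚ.+-identityʳ n))) (δ-≡ n·𝐞₀≡n)) ⟩
    F (n ∷ []) * (sgn n * 1#)
      ≈⟨ *-congˡ (*-identityʳ _) ⟩
    F (n ∷ []) * sgn n ∎
    where
      negX^ : Vec ℕ 1 → Carrier
      negX^ t = prodS R (λ i → powS R (negS R (var R zero)) (lookup t i)) (n ∷ [])
      n·𝐞₀≡n : lincomb (λ _ → 𝐞 zero) (n ∷ []) ≡ n ∷ []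
      n·𝐞₀≡n = cong (_∷ []) (≡.trans (ℕₚ.+-identityʳ _) (ℕₚ.*-identityʳ n))

  zigMinusCoeff : Mould R → ∀ {r} → Vec ℕ r → Carrier
  zigMinusCoeff Ze {r} t = sgn r * (Mig R Ze r (reverse t) * sgn (deg t))

  -- Substituting −Y_r, …, −Y₁ into Zig reverses the exponent vector and contributes (−1)^{|t|}.
  ZigMinus-coefficient : ∀ (Ze : Mould R) {r} (t : Vec ℕ r) → ZigMinus R Ze r t ≈ zigMinusCoeff Ze t
  ZigMinus-coefficient Ze {r} t = *-congˡ (begin
    ∑[ u ∈ comps r (deg t) ] (Mig R Ze r u * prodS R (λ i → powS R (negS R (var R (opposite i))) (lookup u i)) t)
      ≈⟨ ∑-cong (comps r (deg t)) (λ u → *-congˡ (prodS-negVars opposite u t)) ⟩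
    ∑[ u ∈ comps r (deg t) ] (Mig R Ze r u * (sgn (deg u) * δ (lincomb (𝐞 ∘ opposite) u) t))
      ≈⟨ ∑-cong (comps r (deg t)) (λ u → ≈-trans (*-congˡ (*-congˡ (δ-reversed u))) (rotate _ _ _)) ⟩
    ∑[ u ∈ comps r (deg t) ] (δ (reverse t) u * (Mig R Ze r u * sgn (deg u)))
      ≈⟨ comps-pick (deg t) (reverse t) (λ u → Mig R Ze r u * sgn (deg u)) (deg-reverse t) ⟩
    Mig R Ze r (reverse t) * sgn (deg (reverse t))
      ≡⟨ cong (λ d → Mig R Ze r (reverse t) * sgn d) (deg-reverse t) ⟩
    Mig R Ze r (reverse t) * sgn (deg t) ∎)
    where
      δ-reversed : ∀ u → δ (lincomb (𝐞 ∘ opposite) u) t ≈ δ (reverse t) u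
      δ-reversed u = ≈-trans (reflexive (cong (λ z → δ z t) (lincomb-reverse u)))
        (δ-transport (reverse u) t (reverse t) u Vecₚ.reverse-reverse Vecₚ.reverse-reverse)

  -- The right-hand side: expanding each argument Yᵢ − X by the binomial theorem
  -- and collapsing the double sum leaves a sum over the compositions of n.
  ZigMinusShifted-coefficient : ∀ (Ze : Mould R) {r} n (e : Vec ℕ r) →
    ZigMinusShifted R Ze r (n ∷ e) ≈ ∑[ k ∈ comps r n ] (zigMinusCoeff Ze (e ⊕ k) * binomWeight (e ⊕ k) k)
  ZigMinusShifted-coefficient Ze {r} n e = begin
    ∑[ t ∈ comps r (n ℕ.+ deg e) ] (ZigMinus R Ze r t * shift t)
      ≈⟨ ∑-cong (comps r (n ℕ.+ deg e)) (λ t → *-cong (ZigMinus-coefficient Ze t) (shift-coefficient n e t)) ⟩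
    ∑[ t ∈ comps r (n ℕ.+ deg e) ] (zigMinusCoeff Ze t * ∑[ a ∈ below t ] (binomWeight t a * selector t a))
      ≈⟨ ∑-cong (comps r (n ℕ.+ deg e)) (λ t →
           ≈-trans (∑-*ˡ _ _ (below t)) (∑-cong (below t) (λ a → ≈-sym (*-assoc _ _ _)))) ⟩
    (∑[ t ∈ comps r (n ℕ.+ deg e) ] ∑[ a ∈ below t ] ((zigMinusCoeff Ze t * binomWeight t a) * selector t a))
      ≈⟨ comps-shift n e (λ t a → zigMinusCoeff Ze t * binomWeight t a) ⟩
    ∑[ k ∈ comps r n ] (zigMinusCoeff Ze (e ⊕ k) * binomWeight (e ⊕ k) k) ∎
    where
      shift : Vec ℕ r → Carrier
      shift t = prodS R (λ i → powS R (addS R (var R (suc i)) (negS R (var R zero))) (lookup t i)) (n ∷ e)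
      selector : Vec ℕ r → Vec ℕ r → Carrier
      selector t a = δℕ (deg a) n * δ (t ⊖ a) e

  hePlusBinomial : ℕ → ℕ → Carrier
  hePlusBinomial sᵢ kᵢ = natCast R ((sᵢ ℕ.+ kᵢ ℕ.∸ 1) C kᵢ)

  hePlusTerm : Mould R → ∀ {r} → Vec ℕ r → ℕ → Vec ℕ r → Carrier
  hePlusTerm Ze s n k = (prodL R (toList (zipWith hePlusBinomial s k)) * Ze (toList (zipWith ℕ._+_ s k))) * sgn n

  prodL-reverse : ∀ xs → prodL R (List.reverse xs) ≈ prodL R xs
  prodL-reverse xs = foldr-commMonoid *-isCommutativeMonoid (↭-reverse xs)

  -- For sᵢ = eᵢ + 1 the binomial C(sᵢ + kᵢ − 1, kᵢ) of He_+ is C(eᵢ + kᵢ, kᵢ),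
  -- the coefficient produced by the binomial expansion on the other side.
  binomWeight-split : ∀ {m} (e k : Vec ℕ m) →
    binomWeight (e ⊕ k) k ≈ prodL R (toList (zipWith hePlusBinomial (Vec.map suc e) k)) * sgn (deg k)
  binomWeight-split []       []       = ≈-sym (*-identityˡ _)
  binomWeight-split (e₀ ∷ e) (k₀ ∷ k) = ≈-trans (*-congˡ (binomWeight-split e k))
    (≈-trans (*-interchange _ _ _ _) (*-congˡ (≈-sym (sgn-+ k₀ (deg k)))))

  private
    module Monoid = CommMonoidSolver *-commutativeMonoid

  regroup : ∀ a b p z s → (a * b) * (((p * z) * s) * s) ≈ (a * (z * (b * s))) * (p * s)
  regroup = Monoid.solve 5 (λ a b p z s →
    (a Monoid.⊕ b) Monoid.⊕ (((p Monoid.⊕ z) Monoid.⊕ s) Monoid.⊕ s)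
      Monoid.⊜ (a Monoid.⊕ (z Monoid.⊕ (b Monoid.⊕ s))) Monoid.⊕ (p Monoid.⊕ s)) ≈-refl

  hePlusTerm-reversed : ∀ (Ze : Mould R) {r} n (e k : Vec ℕ r) → deg k ≡ n →
    sgn (deg (Vec.map suc e)) * (hePlusTerm Ze (reverse (Vec.map suc e)) n (reverse k) * sgn n)
      ≈ zigMinusCoeff Ze (e ⊕ k) * binomWeight (e ⊕ k) k
  hePlusTerm-reversed Ze {r} n e k |k|≡n = begin
    sgn (deg (Vec.map suc e)) * (((P′ * Z′) * sgn n) * sgn n)
      ≈⟨ *-cong (≈-trans (reflexive (cong sgn (deg-map-suc e))) (sgn-+ r (deg e)))
                (*-congʳ (*-congʳ (*-cong P′≈P (reflexive Z′≡Mig)))) ⟩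
    (sgn r * sgn (deg e)) * (((P * Mig R Ze r (reverse (e ⊕ k))) * sgn n) * sgn n)
      ≈⟨ regroup _ _ _ _ _ ⟩
    (sgn r * (Mig R Ze r (reverse (e ⊕ k)) * (sgn (deg e) * sgn n))) * (P * sgn n)
      ≈⟨ *-cong (*-congˡ (*-congˡ (≈-sym (≈-trans (reflexive (cong sgn |e⊕k|)) (sgn-+ (deg e) n)))))
                (≈-sym (≈-trans (binomWeight-split e k) (*-congˡ (reflexive (cong sgn |k|≡n))))) ⟩
    zigMinusCoeff Ze (e ⊕ k) * binomWeight (e ⊕ k) k ∎
    where
      s : Vec ℕ r
      s = Vec.map suc e
      P P′ Z′ : Carrier
      P  = prodL R (toList (zipWith hePlusBinomial s k))
      P′ = prodL R (toList (zipWith hePlusBinomial (reverse s) (reverse k)))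
      Z′ = Ze (toList (zipWith ℕ._+_ (reverse s) (reverse k)))
      P′≈P : P′ ≈ P
      P′≈P = ≈-trans (reflexive (cong (prodL R ∘ toList) (zipWith-reverse hePlusBinomial s k)))
               (≈-trans (reflexive (cong (prodL R) (Vecₚ.toList-reverse (zipWith hePlusBinomial s k))))
                        (prodL-reverse (toList (zipWith hePlusBinomial s k))))
      Z′≡Mig : Z′ ≡ Mig R Ze r (reverse (e ⊕ k))
      Z′≡Mig = cong (Ze ∘ toList) (≡.trans (zipWith-reverse ℕ._+_ s k)
                 (≡.trans (cong reverse (zipWith-+-suc e k)) (≡.sym (Vecₚ.map-reverse suc (e ⊕ k)))))
      |e⊕k| : deg (e ⊕ k) ≡ deg e ℕ.+ n
      |e⊕k| = ≡.trans (deg-⊕ e k) (cong (deg e ℕ.+_) |k|≡n)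

  -- The left-hand side: substituting −X contributes (−1)ⁿ, and reversing the
  -- summation index matches the terms of He_+ with those of the right-hand side.
  HigMinus-coefficient : ∀ (Ze : Mould R) {r} n (e : Vec ℕ r) →
    HigMinus R Ze r (n ∷ e) ≈ ∑[ k ∈ comps r n ] (zigMinusCoeff Ze (e ⊕ k) * binomWeight (e ⊕ k) k)
  HigMinus-coefficient Ze {r} n e = begin
    σ * substS R (HePlus R Ze s′) (λ _ → negS R (var R zero)) (n ∷ [])
      ≈⟨ *-congˡ (substS-negX (HePlus R Ze s′) n) ⟩
    σ * (∑ (comps r n) (hePlusTerm Ze s′ n) * sgn n)
      ≈⟨ *-congˡ (*-congʳ (comps-reverse n (hePlusTerm Ze s′ n))) ⟩
    σ * (∑[ k ∈ comps r n ] hePlusTerm Ze s′ n (reverse k) * sgn n)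
      ≈⟨ ≈-trans (*-congˡ (∑-*ʳ _ _ (comps r n))) (∑-*ˡ _ _ (comps r n)) ⟩
    ∑[ k ∈ comps r n ] (σ * (hePlusTerm Ze s′ n (reverse k) * sgn n))
      ≈⟨ comps-cong n (hePlusTerm-reversed Ze n e) ⟩
    ∑[ k ∈ comps r n ] (zigMinusCoeff Ze (e ⊕ k) * binomWeight (e ⊕ k) k) ∎
    where
      s′ : Vec ℕ r
      s′ = reverse (Vec.map suc e)
      σ : Carrier
      σ = sgn (deg (Vec.map suc e))

  theorem : ∀ (Ze : Mould R) r (x : Vec ℕ (suc r)) → HigMinus R Ze r x ≈ ZigMinusShifted R Ze r x
  theorem Ze r (n ∷ e) = ≈-trans (HigMinus-coefficient Ze n e) (≈-sym (ZigMinusShifted-coefficient Ze n e))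

mainTheorem6 : ∀ {c ℓ : Level} (R : CommutativeRing c ℓ) (Ze : List ℕ → CommutativeRing.Carrier R) →
    IsSymmetrel R Ze →
    CommutativeRing._≈_ R (Ze (1 ∷ [])) (CommutativeRing.0# R) →
    (r : ℕ) → 1 ≤ r →
    (e : Vec ℕ (suc r)) →
    CommutativeRing._≈_ R (HigMinus R Ze r e) (ZigMinusShifted R Ze r e)
mainTheorem6 R Ze _ _ r _ e = Expansion.theorem R Ze r e
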